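{- The truth of a $\mathcal{D}({\sf M})$-formula may depend on the interpretations of variables that do not occur free in it: there exist a formula $\phi\in\mathcal{D}({\sf M})$, a finite structure ${\mathfrak A}$, a team $X$ and a set of variables $V$ with ${\rm Fr}(\phi)\subseteq V\subseteq{\rm dom}(X)$ such that ${\mathfrak A}\models_{X\upharpoonright V}\phi$ but ${\mathfrak A}\not\models_X\phi$.
   Context: For a team $X$ and $V\subseteq{\rm dom}(X)$, $X\upharpoonright V=\{s\upharpoonright V:s\in X\}$. ${\rm Fr}(\phi)$ is the set of free variables (as in first-order logic; for $=\!\!(t_1,\ldots,t_n)$ all variables in the $t_i$). Dependence logic $\mathcal{D}$: formulas in negation normal form built from first-order literals, dependence atoms $=\!\!(t_1,\ldots,t_n)$ and their negations, using $\wedge,\vee,\exists x,\forall x$. A team $X$ of $A$ with domain ${\rm dom}(X)$ is a set of assignments ${\rm dom}(X)\to A$. For $F:X\to A$, $X(F/x)=\{s(F(s)/x):s\in X\}$, $X(A/x)=\{s(a/x):s\in X,a\in A\}$. Satisfaction ${\mathfrak A}\models_X\phi$: a first-order literal holds iff it holds under every $s\in X$; $=\!\!(t_1,\ldots,t_n)$ holds iff any $s,s'\in X$ agreeing on the values of $t_1,\ldots,t_{n-1}$ agree on $t_n$ (the atom $=\!\!(t)$ thus says $t$ is constant on $X$); $\neg=\!\!(\ldots)$ holds iff $X=\emptyset$; $\wedge$ conjunction; $\psi\vee\chi$ iff $X=Y\cup Z$ with $\psi$ in $Y$, $\chi$ in $Z$; $\exists x\psi$ iff $\psi$ holds in $X(F/x)$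 for some $F:X\to A$; $\forall x\psi$ iff $\psi$ holds in $X(A/x)$; ${\mathfrak A}\models_X{\sf M}x\psi$ iff for at least $|A|^{|X|}/2$ many $F:X\to A$, ${\mathfrak A}\models_{X(F/x)}\psi$. $\mathcal{D}({\sf M})$ is $\mathcal{D}$ extended by ${\sf M}$. -}

module Defs where

open import Level using (0ℓ)
open import Data.Nat using (ℕ; zero; suc; _^_; _*_; _≤_)
open import Data.Bool using (Bool; true; false; _∧_; _∨_; if_then_else_)
open import Data.Fin using (Fin; zero; suc; _≟_)
open import Data.Fin.Subset using (Subset; _∪_; _-_; ⁅_⁆; ⊥)
open import Data.Vec using (Vec; []; _∷_; lookup; _[_]≔_; tabulate)
open import Data.Vec.Properties using (≡-dec)
open import Data.List using (List; []; _∷_; concatMap; map; allFin; filterᵇ; length)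
open import Data.Bool.ListAction using (any)
open import Data.Product using (Σ; ∃; _×_; _,_)
open import Relation.Binary.PropositionalEquality using (_≡_; _≢_)
open import Relation.Nullary using (¬_; does)

-- Vocabularies, terms and D(M)-formulas.
-- Variables of a formula are drawn from Fin N (every formula uses only
-- finitely many variables, so this is no restriction).

record Signature : Set₁ where
  field
    Fun      : Set
    funArity : Fun → ℕ
    Rel      : Set
    relArity : Rel → ℕ

module Syntax (σ : Signature) where
  open Signature σ

  data Term (N : ℕ) : Set where
    var : Fin N → Term N
    app : (f : Fun) → Vec (Term N) (funArity f) → Term N

  -- Formulas of dependence logic with the quantifier M, in negation normal form.
  -- dep ts t  is the dependence atom  =(t₁,…,t_{n-1},t)  with ts = t₁…t_{n-1}.
  data Formula (N : ℕ) : Set where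
    eq   : Term N → Term N → Formula N
    neq  : Term N → Term N → Formula N
    rel  : (R : Rel) → Vec (Term N) (relArity R) → Formula N
    nrel : (R : Rel) → Vec (Term N) (relArity R) → Formula N
    dep  : ∀ {k} → Vec (Term N) k → Term N → Formula N
    ndep : ∀ {k} → Vec (Term N) k → Term N → Formula N
    and  : Formula N → Formula N → Formula N
    or   : Formula N → Formula N → Formula N
    ex   : Fin N → Formula N → Formula N
    all  : Fin N → Formula N → Formula N
    most : Fin N → Formula N → Formula N

  mutual
    varsT : ∀ {N} → Term N → Subset N
    varsT (var x)    = ⁅ x ⁆
    varsT (app f ts) = varsTs ts

    varsTs : ∀ {N k} → Vec (Term N) k → Subset N
    varsTs []       = ⊥
    varsTs (t ∷ ts) = varsT t ∪ varsTs ts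

  Fr : ∀ {N} → Formula N → Subset N
  Fr (eq t u)    = varsT t ∪ varsT u
  Fr (neq t u)   = varsT t ∪ varsT u
  Fr (rel R ts)  = varsTs ts
  Fr (nrel R ts) = varsTs ts
  Fr (dep ts t)  = varsTs ts ∪ varsT t
  Fr (ndep ts t) = varsTs ts ∪ varsT t
  Fr (and φ ψ)   = Fr φ ∪ Fr ψ
  Fr (or φ ψ)    = Fr φ ∪ Fr ψ
  Fr (ex x φ)    = Fr φ - x
  Fr (all x φ)   = Fr φ - x
  Fr (most x φ)  = Fr φ - x

-- Finite structures: universe Fin (suc m), i.e. a nonempty finite set
-- of size  suc m.

record Structure (σ : Signature) : Set₁ where
  open Signature σ
  field
    m        : ℕ
    funInt   : (f : Fun) → Vec (Fin (suc m)) (funArity f) → Fin (suc m)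
    relInt   : (R : Rel) → Vec (Fin (suc m)) (relArity R) → Set

-- An assignment with domain D ⊆ Fin N into a universe A = Fin (suc m) is
-- represented canonically as a vector s : Vec A N whose entries at
-- variables outside D are the fixed element zero.

module Teams (m N : ℕ) where
  A : Set
  A = Fin (suc m)

  Asg : Set
  Asg = Vec A N

  Team : Set
  Team = Asg → Bool

  allVecs : ∀ k → List (Vec A k)
  allVecs zero    = [] ∷ []
  allVecs (suc k) = concatMap (λ a → map (a ∷_) (allVecs k)) (allFin (suc m))

  _==_ : Asg → Asg → Bool
  s == t = does (≡-dec _≟_ s t)

  TeamWithDom : Subset N → Team → Set
  TeamWithDom D X = ∀ s → X s ≡ true → ∀ i → lookup D i ≡ false → lookup s i ≡ zero

  size : Team → ℕ
  size X = length (filterᵇ X (allVecs N))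

  -- X(F/x) for F : X → A (given as a function on all assignments; only its
  -- values on members of X matter)
  supplement : Team → (Asg → A) → Fin N → Team
  supplement X F x t = any (λ s → X s ∧ ((s [ x ]≔ F s) == t)) (allVecs N)

  duplicate : Team → Fin N → Team
  duplicate X x t =
    any (λ s → X s ∧ any (λ a → (s [ x ]≔ a) == t) (allFin (suc m))) (allVecs N)

  restrictAsg : Subset N → Asg → Asg
  restrictAsg V s = tabulate (λ i → if lookup V i then lookup s i else zero)

  restrict : Team → Subset N → Team
  restrict X V t = any (λ s → X s ∧ (restrictAsg V s == t)) (allVecs N)

  DifferentOn : Team → (Asg → A) → (Asg → A) → Set
  DifferentOn X F G = Σ Asg (λ s → X s ≡ true × F s ≢ G s)

module Semantics {σ : Signature} (𝔄 : Structure σ) where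
  open Signature σ
  open Structure 𝔄
  open Syntax σ

  module _ {N : ℕ} where
    open Teams m N

    mutual
      ⟦_⟧ : Term N → Asg → A
      ⟦ var x ⟧    s = lookup s x
      ⟦ app f ts ⟧ s = funInt f (⟦ ts ⟧s s)

      ⟦_⟧s : ∀ {k} → Vec (Term N) k → Asg → Vec A k
      ⟦ [] ⟧s     s = []
      ⟦ t ∷ ts ⟧s s = ⟦ t ⟧ s ∷ ⟦ ts ⟧s s

    _⊨_ : Team → Formula N → Set
    X ⊨ eq t u    = ∀ s → X s ≡ true → ⟦ t ⟧ s ≡ ⟦ u ⟧ s
    X ⊨ neq t u   = ∀ s → X s ≡ true → ⟦ t ⟧ s ≢ ⟦ u ⟧ s
    X ⊨ rel R ts  = ∀ s → X s ≡ true → relInt R (⟦ ts ⟧s s)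
    X ⊨ nrel R ts = ∀ s → X s ≡ true → ¬ relInt R (⟦ ts ⟧s s)
    X ⊨ dep ts t  = ∀ s s′ → X s ≡ true → X s′ ≡ true →
                    ⟦ ts ⟧s s ≡ ⟦ ts ⟧s s′ → ⟦ t ⟧ s ≡ ⟦ t ⟧ s′
    X ⊨ ndep ts t = ∀ s → X s ≡ false
    X ⊨ and φ ψ   = (X ⊨ φ) × (X ⊨ ψ)
    X ⊨ or φ ψ    = Σ Team λ Y → Σ Team λ Z →
                    (∀ s → X s ≡ (Y s ∨ Z s)) × (Y ⊨ φ) × (Z ⊨ ψ)
    X ⊨ ex x φ    = Σ (Asg → A) λ F → supplement X F x ⊨ φ
    X ⊨ all x φ   = duplicate X x ⊨ φ
    -- at least |A|^|X| / 2 many pairwise different F : X → A with X(F/x) ⊨ φ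
    X ⊨ most x φ  = Σ ℕ λ k → Σ (Fin k → Asg → A) λ G →
                    (∀ i j → i ≢ j → DifferentOn X (G i) (G j)) ×
                    (∀ i → supplement X (G i) x ⊨ φ) ×
                    (suc m ^ size X ≤ 2 * k)

module Submission where

-- The witness is  φ = M x (x = c)  for a constant c.  A function F : X → A
-- makes  x = c  true in X(F/x) exactly when F is constantly ⟦c⟧ on X, so
-- at most one function X → A qualifies and φ holds in X exactly when
-- |A|^|X| ≤ 2.  Over a two-element universe this is true for a singleton
-- team and false for a team with two assignments.  Take X = {(0,0),(0,1)}
-- with domain {x₀,x₁}: φ has no free variables, X ↾ ∅ is a singleton, so
-- 𝔄 ⊨_{X↾∅} φ while 𝔄 ⊭_X φ.

open import Defs
open import Data.Nat using (ℕ; zero; suc; _^_; _≤_; s≤s; z≤n)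
open import Data.Nat.Properties using (≤-refl; ≤-trans)
open import Data.Fin using (Fin; zero; suc; _≟_)
open import Data.Fin.Subset using (Subset; _⊆_; ⊥; ⊤)
open import Data.Fin.Subset.Properties using (⊥⊆)
open import Data.Vec using (Vec; []; _∷_; lookup; _[_]≔_; there)
open import Data.Vec.Properties using (≡-dec; lookup∘update; lookup-replicate)
open import Data.List.Relation.Unary.Any using (here; satisfied)
open import Data.List.Relation.Unary.Any.Properties using (any⁺; any⁻)
open import Data.List.Membership.Propositional using (_∈_; lose)
open import Data.List.Membership.Propositional.Properties
  using (∈-concatMap⁺; ∈-map⁺; ∈-allFin)
open import Data.Bool using (Bool; true; false; _∧_)
open import Data.Bool.ListAction using (any)
open import Data.Bool.Properties using (T-≡)
open import Data.Unit using (tt) renaming (⊤ to Unit)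
open import Data.Empty using (⊥-elim) renaming (⊥ to Empty)
open import Data.Product using (Σ; _×_; _,_)
open import Function.Bundles using (Equivalence)
open import Relation.Nullary using (¬_; yes)
open import Relation.Nullary.Decidable using (dec-true)
open import Relation.Binary.PropositionalEquality
  using (_≡_; refl; sym; trans; cong; module ≡-Reasoning)
open ≡-Reasoning

module TeamFacts (m N : ℕ) where
  open Teams m N

  ∈-allVecs : ∀ k (s : Vec A k) → s ∈ allVecs k
  ∈-allVecs zero    []       = here refl
  ∈-allVecs (suc k) (a ∷ s) =
    ∈-concatMap⁺ _ (lose (∈-allFin a) (∈-map⁺ (a ∷_) (∈-allVecs k s)))

  any-complete : (p : Asg → Bool) (s : Asg) → p s ≡ true → any p (allVecs N) ≡ true
  any-complete p s ps =
    Equivalence.to T-≡ (any⁺ p (lose (∈-allVecs N s) (Equivalence.from T-≡ ps)))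

  any-sound : (p : Asg → Bool) → any p (allVecs N) ≡ true → Σ Asg λ s → p s ≡ true
  any-sound p found with satisfied (any⁻ p (allVecs N) (Equivalence.from T-≡ found))
  ... | s , ps = s , Equivalence.to T-≡ ps

  ==-refl : (s : Asg) → (s == s) ≡ true
  ==-refl s = dec-true (≡-dec _≟_ s s) refl

  ==-sound : (s t : Asg) → (s == t) ≡ true → s ≡ t
  ==-sound s t eq with ≡-dec _≟_ s t
  ... | yes s≡t = s≡t

  ∧-split : ∀ {b c : Bool} → (b ∧ c) ≡ true → b ≡ true × c ≡ true
  ∧-split {true} {true} refl = refl , refl

  supplement-complete : (X : Team) (F : Asg → A) (x : Fin N) (s : Asg) →
    X s ≡ true → supplement X F x (s [ x ]≔ F s) ≡ true
  supplement-complete X F x s s∈X =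
    any-complete _ s (trans (cong (_∧ _) s∈X) (==-refl (s [ x ]≔ F s)))

  supplement-sound : (X : Team) (F : Asg → A) (x : Fin N) (u : Asg) →
    supplement X F x u ≡ true → Σ Asg λ s → X s ≡ true × (s [ x ]≔ F s) ≡ u
  supplement-sound X F x u u∈XF with any-sound _ u∈XF
  ... | s , hit with ∧-split {X s} hit
  ...   | s∈X , upd = s , s∈X , ==-sound _ u upd

  full-domain : (X : Team) → TeamWithDom ⊤ X
  full-domain X s _ i i∉⊤ with () ← trans (sym (lookup-replicate i true)) i∉⊤

module MostOfConstant {σ : Signature} (𝔄 : Structure σ) {N : ℕ} where
  open Structure 𝔄 using (m)
  open Syntax σ
  open Teams m N
  open TeamFacts m N
  open Semantics 𝔄

  Constant : Term N → Set
  Constant t = ∀ s s′ → ⟦ t ⟧ s ≡ ⟦ t ⟧ s′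

  module _ (t : Term N) (const : Constant t) (X : Team) (x : Fin N) where

    witness-forced : (F : Asg → A) → supplement X F x ⊨ eq (var x) t →
      ∀ s → X s ≡ true → F s ≡ ⟦ t ⟧ s
    witness-forced F sat s s∈X = begin
      F s                      ≡⟨ sym (lookup∘update x s (F s)) ⟩
      lookup (s [ x ]≔ F s) x  ≡⟨ sat _ (supplement-complete X F x s s∈X) ⟩
      ⟦ t ⟧ (s [ x ]≔ F s)     ≡⟨ const _ s ⟩
      ⟦ t ⟧ s                  ∎

    value-witness : supplement X ⟦ t ⟧ x ⊨ eq (var x) t
    value-witness u u∈XF with supplement-sound X ⟦ t ⟧ x u u∈XF
    ... | s , _ , refl = trans (lookup∘update x s (⟦ t ⟧ s)) (const s _)

    unique-witness : (F G : Asg → A) →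
      supplement X F x ⊨ eq (var x) t → supplement X G x ⊨ eq (var x) t →
      ¬ DifferentOn X F G
    unique-witness F G satF satG (s , s∈X , Fs≢Gs) =
      Fs≢Gs (trans (witness-forced F satF s s∈X) (sym (witness-forced G satG s s∈X)))

    -- X ⊨ M x (x = t) iff |A|^|X| ≤ 2: exactly one function X → A qualifies.
    most-constant-bound : X ⊨ most x (eq (var x) t) → suc m ^ size X ≤ 2
    most-constant-bound (zero , _ , _ , _ , bound) = ≤-trans bound z≤n
    most-constant-bound (suc zero , _ , _ , _ , bound) = bound
    most-constant-bound (suc (suc k) , G , different , sat , _) with
      () ← unique-witness (G zero) (G (suc zero)) (sat zero) (sat (suc zero))
             (different zero (suc zero) λ ())

    most-constant-holds : suc m ^ size X ≤ 2 → X ⊨ most x (eq (var x) t)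
    most-constant-holds bound =
      1 , (λ _ → ⟦ t ⟧) , (λ { zero zero 0≢0 → ⊥-elim (0≢0 refl) }) ,
      (λ _ → value-witness) , bound

constantSignature : Signature
constantSignature = record
  { Fun = Unit ; funArity = λ _ → 0 ; Rel = Empty ; relArity = λ () }

twoElements : Structure constantSignature
twoElements = record { m = 1 ; funInt = λ _ _ → zero ; relInt = λ () }

open Syntax constantSignature using (Formula; Term; var; app; eq; most; Fr)
open Teams 1 2 using (Team; restrict; size)
open MostOfConstant twoElements using (Constant; most-constant-bound; most-constant-holds)

c : Term 2
c = app tt []

c-constant : Constant c
c-constant _ _ = refl

φ : Formula 2
φ = most zero (eq (var zero) c)

X : Team
X (zero ∷ zero ∷ [])     = true
X (zero ∷ suc zero ∷ []) = true
X _                      = false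

proposition2p13 : Σ Signature λ σ → Σ (Structure σ) λ 𝔄 → Σ ℕ λ N →
    Σ (Syntax.Formula σ N) λ φ →
    Σ (Subset N) λ D → Σ (Teams.Team (Structure.m 𝔄) N) λ X → Σ (Subset N) λ V →
    Teams.TeamWithDom (Structure.m 𝔄) N D X × Syntax.Fr σ φ ⊆ V × V ⊆ D ×
    Semantics._⊨_ 𝔄 (Teams.restrict (Structure.m 𝔄) N X V) φ ×
    ¬ Semantics._⊨_ 𝔄 X φ
proposition2p13 =
  constantSignature , twoElements , 2 , φ , ⊤ , X , ⊥ ,
  TeamFacts.full-domain 1 2 X , φ-closed , ⊥⊆ ,
  -- |X ↾ ∅| = 1 and 2¹ ≤ 2
  most-constant-holds c c-constant (restrict X ⊥) zero ≤-refl ,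
  -- |X| = 2 but 2² ≰ 2
  λ X⊨φ → four≰two (most-constant-bound c c-constant X zero X⊨φ)
  where
  φ-closed : Fr φ ⊆ ⊥
  φ-closed {zero}     ()
  φ-closed {suc zero} (there ())

  four≰two : ¬ (4 ≤ 2)
  four≰two (s≤s (s≤s ()))
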